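{- For any finite set $\{\phi_i\mid i\in I\}$ of PNL propositions there exists a finite list $D$ of distinct atoms such that $D\vdash\phi_i$ for every $i\in I$.
   Context: PNL propositions are built from $\bot$, $\phi\supset\psi$, $\mathsf P(r)$ and $\forall X.\phi$, where terms $r$ are atoms, tuples, $\mathsf f(r)$, abstractions $[a]r$ and moderated unknowns $\pi\cdot X$ ($\pi$ a finitely supported bijection of atoms with $\mathrm{nontriv}(\pi)=\{a\mid\pi(a)\neq a\}$; $X$ an unknown with a permission set $\mathrm{pmss}(X)$ of atoms). Capture typing $D\vdash r:A$ (for $D$ a finite list of distinct atoms and $A$ a finite set of atoms) is defined inductively: $D\vdash a:A$ and $D\vdash\bot:A$ always; $\mathsf f(r)$, $\mathsf P(r)$, $\forall X.\phi$, tuples and $\phi\supset\psi$ are typable with $A$ if all their immediate parts are; $D\vdash[a]r:A$ if $D\vdash r:A\cup\{a\}$; $D\vdash\pi\cdot X:A$ if $(\mathrm{nontriv}(\pi)\cup A)\cap\mathrm{pmss}(X)\subseteq D$ (viewing $D$ as a set). $D\vdash\phi$ means $D\vdash\phi:\emptyset$. -}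

module Defs where

open import Data.Nat using (ℕ)
open import Data.List using (List; _∷_; [])
open import Data.List.Membership.Propositional using (_∈_)
open import Data.List.Relation.Unary.All using (All)
open import Data.Sum using (_⊎_)
open import Relation.Binary.PropositionalEquality using (_≡_; _≢_)
open import Level using (0ℓ)

Atom : Set
Atom = ℕ

Unknown : Set
Unknown = ℕ

record Perm : Set where
  field
    fun     : Atom → Atom
    inv     : Atom → Atom
    inv-l   : ∀ a → inv (fun a) ≡ a
    inv-r   : ∀ a → fun (inv a) ≡ a
    support : List Atom
    finSupp : ∀ a → fun a ≢ a → a ∈ support

open Perm public

nontriv : Perm → Atom → Set
nontriv π a = fun π a ≢ a

data Term : Set where
  atom  : Atom → Term
  tuple : List Term → Term
  app   : ℕ → Term → Term
  abs   : Atom → Term → Term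
  mod   : Perm → Unknown → Term

data Prop : Set where
  ⊥'    : Prop
  _⊃_   : Prop → Prop → Prop
  pred  : ℕ → Term → Prop
  all'  : Unknown → Prop → Prop

-- Capture typing, parameterised by the permission-set assignment
-- pmss : Unknown → (Atom → Set).  D is a list, A a finite set (as a list).
module Typing (pmss : Unknown → Atom → Set) where

  data _⊢t_∶_ (D : List Atom) : Term → List Atom → Set where
    t-atom  : ∀ {a A} → D ⊢t atom a ∶ A
    t-tuple : ∀ {rs A} → All (λ r → D ⊢t r ∶ A) rs → D ⊢t tuple rs ∶ A
    t-app   : ∀ {f r A} → D ⊢t r ∶ A → D ⊢t app f r ∶ A
    t-abs   : ∀ {a r A} → D ⊢t r ∶ (a ∷ A) → D ⊢t abs a r ∶ A
    t-mod   : ∀ {π X A} →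
              (∀ b → (nontriv π b ⊎ b ∈ A) → pmss X b → b ∈ D) →
              D ⊢t mod π X ∶ A

  data _⊢p_∶_ (D : List Atom) : Prop → List Atom → Set where
    p-bot  : ∀ {A} → D ⊢p ⊥' ∶ A
    p-imp  : ∀ {φ ψ A} → D ⊢p φ ∶ A → D ⊢p ψ ∶ A → D ⊢p (φ ⊃ ψ) ∶ A
    p-pred : ∀ {P r A} → D ⊢t r ∶ A → D ⊢p pred P r ∶ A
    p-all  : ∀ {X φ A} → D ⊢p φ ∶ A → D ⊢p all' X φ ∶ A

  _⊢_ : List Atom → Prop → Set
  D ⊢ φ = D ⊢p φ ∶ []

-- Capture typing only ever asks for atoms that occur syntactically in a
-- proposition: abstracted atoms (which enter the set A) and the non-trivial
-- atoms of the permutations π in π·X (all lying in the listed support of π).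
-- Hence any D containing all these atoms types the proposition, and the
-- duplicate-free list of the atoms of all φ i serves as a common D.
module Submission where

open import Defs
open import Data.Nat using (ℕ; _≟_)
open import Data.Fin using (Fin)
open import Data.List using (List; []; _∷_; _++_; concat; map; allFin; deduplicate)
open import Data.List.Relation.Unary.All using (All; []; _∷_)
open import Data.List.Relation.Unary.Any using (here; there)
open import Data.List.Relation.Binary.Subset.Propositional using (_⊆_)
open import Data.List.Relation.Binary.Subset.Propositional.Properties
  using (⊆-trans; xs⊆xs++ys; xs⊆ys++xs; ∈-∷⁺ʳ)
open import Data.List.Membership.Propositional.Properties
  using (∈-concat⁺′; ∈-map⁺; ∈-allFin; ∈-deduplicate⁺)
open import Data.List.Relation.Unary.Unique.Propositional using (Unique)
open import Data.List.Relation.Unary.Unique.DecPropositional.Properties _≟_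
  using (deduplicate-!)
open import Data.Product using (Σ; _×_; _,_)
open import Data.Sum using ([_,_])
open import Function using (_∘_)
open import Relation.Binary.PropositionalEquality using (refl)

mutual
  atomsᵗ : Term → List Atom
  atomsᵗ (atom a)   = []
  atomsᵗ (tuple rs) = atomsᵗˢ rs
  atomsᵗ (app f r)  = atomsᵗ r
  atomsᵗ (abs a r)  = a ∷ atomsᵗ r
  atomsᵗ (mod π X)  = support π

  atomsᵗˢ : List Term → List Atom
  atomsᵗˢ []       = []
  atomsᵗˢ (r ∷ rs) = atomsᵗ r ++ atomsᵗˢ rs

atomsᵖ : Prop → List Atom
atomsᵖ ⊥'         = []
atomsᵖ (φ ⊃ ψ)    = atomsᵖ φ ++ atomsᵖ ψ
atomsᵖ (pred P r) = atomsᵗ r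
atomsᵖ (all' X φ) = atomsᵖ φ

atomsᶠ : (n : ℕ) → (Fin n → Prop) → List Atom
atomsᶠ n φ = concat (map (atomsᵖ ∘ φ) (allFin n))

atomsᵖ⊆atomsᶠ : ∀ n (φ : Fin n → Prop) i → atomsᵖ (φ i) ⊆ atomsᶠ n φ
atomsᵖ⊆atomsᶠ n φ i b∈ = ∈-concat⁺′ b∈ (∈-map⁺ (atomsᵖ ∘ φ) (∈-allFin i))

module _ (pmss : Unknown → Atom → Set) where
  open Typing pmss

  mutual
    ⊢t-from-⊆ : ∀ {D} r {A} → atomsᵗ r ⊆ D → A ⊆ D → D ⊢t r ∶ A
    ⊢t-from-⊆ (atom a)   r⊆D A⊆D = t-atom
    ⊢t-from-⊆ (tuple rs) r⊆D A⊆D = t-tuple (⊢ts-from-⊆ rs r⊆D A⊆D)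
    ⊢t-from-⊆ (app f r)  r⊆D A⊆D = t-app (⊢t-from-⊆ r r⊆D A⊆D)
    ⊢t-from-⊆ (abs a r)  r⊆D A⊆D =
      t-abs (⊢t-from-⊆ r (r⊆D ∘ there) (∈-∷⁺ʳ (r⊆D (here refl)) A⊆D))
    ⊢t-from-⊆ (mod π X)  π⊆D A⊆D =
      t-mod λ b b∈ _ → [ π⊆D ∘ finSupp π b , A⊆D ] b∈

    ⊢ts-from-⊆ : ∀ {D} rs {A} → atomsᵗˢ rs ⊆ D → A ⊆ D → All (λ r → D ⊢t r ∶ A) rs
    ⊢ts-from-⊆ []       rs⊆D A⊆D = []
    ⊢ts-from-⊆ (r ∷ rs) rs⊆D A⊆D =
      ⊢t-from-⊆ r (⊆-trans (xs⊆xs++ys _ _) rs⊆D) A⊆D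
      ∷ ⊢ts-from-⊆ rs (⊆-trans (xs⊆ys++xs _ (atomsᵗ r)) rs⊆D) A⊆D

  ⊢-from-⊆ : ∀ {D} φ → atomsᵖ φ ⊆ D → D ⊢ φ
  ⊢-from-⊆ ⊥'         φ⊆D = p-bot
  ⊢-from-⊆ (φ ⊃ ψ)    φ⊆D = p-imp (⊢-from-⊆ φ (⊆-trans (xs⊆xs++ys _ _) φ⊆D))
                                  (⊢-from-⊆ ψ (⊆-trans (xs⊆ys++xs _ (atomsᵖ φ)) φ⊆D))
  ⊢-from-⊆ (pred P r) φ⊆D = p-pred (⊢t-from-⊆ r φ⊆D λ ())
  ⊢-from-⊆ (all' X φ) φ⊆D = p-all (⊢-from-⊆ φ φ⊆D)

lemma4p15 : (pmss : Unknown → Atom → Set) (n : ℕ) (φ : Fin n → Prop) →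
    Σ (List Atom) (λ D → Unique D × ((i : Fin n) → Typing._⊢_ pmss D (φ i)))
lemma4p15 pmss n φ = D , deduplicate-! (atomsᶠ n φ) , λ i →
  ⊢-from-⊆ pmss (φ i) (∈-deduplicate⁺ _≟_ ∘ atomsᵖ⊆atomsᶠ n φ i)
  where D = deduplicate _≟_ (atomsᶠ n φ)
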